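{- Let $(\Delta X)_X$ be a quasi-regular family over the ranked alphabet $\Sigma$, and let $A$ be a $\Delta$-regular algebra with structure map $\beta:\mathrm{FT}_\Sigma A\to A$. Extend $\beta$ to $\Delta A$ by defining, for $t\in\Delta A$, $$\beta(t)=\bigvee\{\beta(s)\mid s\ll t\}$$ (this supremum exists since it is the supremum of a $\Delta$-set). Then $(A,\beta)$ is an Eilenberg–Moore algebra for the monad $\Delta$, i.e. $\beta(a)=a$ for every $a\in A$ (viewed as a one-node term), and $\beta(\mu_A(T))=\beta((\Delta\beta)(T))$ for every $T\in\Delta(\Delta A)$.
   Context: $\Sigma$ is a ranked alphabet. An ordered $\Sigma$-algebra is a $\Sigma$-algebra partially ordered by $\le$ with least element $\bot$ whose operations are monotone. $\mathrm{CT}_\Sigma X$ is the set of partial $\Sigma$-coterms over a set $X$ (finite or infinite trees with internal nodes labelled by symbols of $\Sigma$ of arity equal to their number of children, and leaves labelled by constants of $\Sigma$, elements of $X$, or the empty term $\bot$), ordered by $s\le t$ iff $t$ arises from $s$ by replacing occurrences of $\bot$ by coterms; it is the free $\omega$-continuous ordered $\Sigma$-algebra on $X$ (every countable directed set has a supremum, operations preserve such suprema; morphisms are strict monotone operation-preserving maps preserving these suprema). $\mathrm{FT}_\Sigma X\subseteq\mathrm{CT}_\Sigma X$ is the set of finite partial terms. A quasi-regular family assigns to each set $X$ an ordered subalgebra $\Delta X$ of $\mathrm{CT}_\Sigma X$ containing $X$ such that for all sets $X,Y$ and every $\omega$-continuous algebra morphism $h:\mathrm{CT}_\Sigma X\to\mathrm{CT}_\Sigma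 Y$ with $h(X)\subseteq\Delta Y$ one has $h(\Delta X)\subseteq\Delta Y$. Then $\Delta$ is a monad: for a map $g:A\to B$, $\Delta g:\Delta A\to\Delta B$ replaces each leaf label $a\in A$ by $g(a)$; the unit sends $a\in A$ to the one-node term $a$; the multiplication $\mu_A:\Delta(\Delta A)\to\Delta A$ substitutes, for each leaf labelled by $s\in\Delta A$, the coterm $s$. For $t_1,t_2\in\mathrm{CT}_\Sigma X$ write $t_1\ll t_2$ if $t_1\in\mathrm{FT}_\Sigma X$ and $t_1$ can be obtained from $t_2$ by replacing some subterms by $\bot$. For an ordered $\Sigma$-algebra $A$, $\beta:\mathrm{FT}_\Sigma A\to A$ is the evaluation of finite partial terms (leaf $a\mapsto a$, $\bot\mapsto\bot^A$, $f(s_1,\dots,s_n)\mapsto f^A(\beta(s_1),\dots,\beta(s_n))$). A subset $B\subseteq A$ is a $\Delta$-set if there is $t\in\Delta A$ with $B=\{\beta(s)\mid s\ll t\}$. $A$ is $\Delta$-regular if every $\Delta$-set has a supremum in $A$ and the operations preserve suprema of $\Delta$-sets: for $f\in\Sigma_n$ and $\Delta$-sets $C_1,\dots,C_n$, $f^A(\bigvee C_1,\dots,\bigvee C_n)=\bigvee\{f^A(c_1,\dots,c_n)\mid c_i\in C_i\}$. -}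

module Defs where

open import Level using (0ℓ)
open import Data.Nat using (ℕ; _<_; _<?_)
open import Data.Fin using (Fin; toℕ; fromℕ<)
open import Data.List using (List; []; _∷_; _++_)
open import Data.Product using (Σ; ∃; _×_; _,_; proj₁)
open import Data.Empty using () renaming (⊥ to Empty)
open import Data.Unit using (⊤)
open import Relation.Nullary using (yes; no)
open import Relation.Binary.PropositionalEquality using (_≡_)
open import Relation.Binary.Bundles using (Poset)

record RankedAlphabet : Set₁ where
  field
    Sym : Set
    ar  : Sym → ℕ

module _ (Σ' : RankedAlphabet) where
  open RankedAlphabet Σ'

  -- Partial Σ-coterms over X.
  -- A (possibly infinite) tree is given by the label of each position,
  -- a position being a path of child indices from the root.

  data Lbl (X : Set) : Set where
    none : Lbl X                -- no node at this position
    ⊥ₗ   : Lbl X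
    varₗ : X → Lbl X
    opₗ  : Sym → Lbl X

  Tree : Set → Set
  Tree X = List ℕ → Lbl X

  IsNode : ∀ {X} → Lbl X → Set
  IsNode none = Empty
  IsNode _    = ⊤

  HasChild : ∀ {X} → Lbl X → ℕ → Set
  HasChild (opₗ f) i = i < ar f
  HasChild _       i = Empty

  IsCoterm : ∀ {X} → Tree X → Set
  IsCoterm t = IsNode (t []) ×
    (∀ p i → (IsNode (t (p ++ i ∷ [])) → HasChild (t p) i)
           × (HasChild (t p) i → IsNode (t (p ++ i ∷ []))))

  _≗ᵗ_ : ∀ {X} → Tree X → Tree X → Set
  s ≗ᵗ t = ∀ p → s p ≡ t p

  sub : ∀ {X} → Tree X → ℕ → Tree X
  sub t i p = t (i ∷ p)

  leaf : ∀ {X} → X → Tree X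
  leaf x []      = varₗ x
  leaf x (_ ∷ _) = none

  ⊥ᶜ : ∀ {X} → Tree X
  ⊥ᶜ []      = ⊥ₗ
  ⊥ᶜ (_ ∷ _) = none

  opᶜ : ∀ {X} (f : Sym) → (Fin (ar f) → Tree X) → Tree X
  opᶜ f ts []      = opₗ f
  opᶜ f ts (i ∷ p) with i <? ar f
  ... | yes i<n = ts (fromℕ< i<n) p
  ... | no  _   = none

  subst : ∀ {X Y} → (X → Tree Y) → Tree X → Tree Y
  subst σ t p = go (t []) p
    where
    go : _ → List ℕ → _
    go none     _       = none
    go ⊥ₗ       []      = ⊥ₗ
    go ⊥ₗ       (_ ∷ _) = none
    go (varₗ x) q       = σ x q
    go (opₗ f)  []      = opₗ f
    go (opₗ f)  (i ∷ q) = subst σ (sub t i) q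

  relabel : ∀ {X Y} → (X → Y) → Lbl X → Lbl Y
  relabel g none     = none
  relabel g ⊥ₗ       = ⊥ₗ
  relabel g (varₗ x) = varₗ (g x)
  relabel g (opₗ f)  = opₗ f

  mapCT : ∀ {X Y} → (X → Y) → Tree X → Tree Y
  mapCT g t p = relabel g (t p)

  data FT (X : Set) : Set where
    ⊥ᶠ   : FT X
    varᶠ : X → FT X
    opᶠ  : (f : Sym) → (Fin (ar f) → FT X) → FT X

  data _≪_ {X : Set} : FT X → Tree X → Set where
    ≪⊥   : ∀ {t} → ⊥ᶠ ≪ t
    ≪var : ∀ {x t} → t [] ≡ varₗ x → varᶠ x ≪ t
    ≪op  : ∀ {f t} {ss : Fin (ar f) → FT X} → t [] ≡ opₗ f →
           (∀ i → ss i ≪ sub t (toℕ i)) → opᶠ f ss ≪ t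

  record QuasiRegular (Δ : (X : Set) → Tree X → Set) : Set₁ where
    field
      coterm    : ∀ {X} {t : Tree X} → Δ X t → IsCoterm t
      resp      : ∀ {X} {s t : Tree X} → s ≗ᵗ t → Δ X s → Δ X t
      has-var   : ∀ {X} (x : X) → Δ X (leaf x)
      has-⊥     : ∀ {X} → Δ X ⊥ᶜ
      has-op    : ∀ {X} (f : Sym) (ts : Fin (ar f) → Tree X) →
                  (∀ i → Δ X (ts i)) → Δ X (opᶜ f ts)
      -- closure under ω-continuous morphisms h : CT X → CT Y with h(X) ⊆ Δ Y;
      -- by freeness of CT X these are exactly the substitutions subst σ.
      closed    : ∀ {X Y} (σ : X → Tree Y) → (∀ x → Δ Y (σ x)) →
                  ∀ t → Δ X t → Δ Y (subst σ t)

  record OrderedAlgebra : Set₁ where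
    field
      poset : Poset 0ℓ 0ℓ 0ℓ
    open Poset poset public
    field
      ⊥ᴬ    : Carrier
      ⊥-min : ∀ a → ⊥ᴬ ≤ a
      opᴬ   : (f : Sym) → (Fin (ar f) → Carrier) → Carrier
      mono  : ∀ f (xs ys : Fin (ar f) → Carrier) →
              (∀ i → xs i ≤ ys i) → opᴬ f xs ≤ opᴬ f ys

  module _ (A : OrderedAlgebra) where
    open OrderedAlgebra A

    βᶠ : FT Carrier → Carrier
    βᶠ ⊥ᶠ = ⊥ᴬ
    βᶠ (varᶠ a) = a
    βᶠ (opᶠ f ss) = opᴬ f (λ i → βᶠ (ss i))

    IsSup : (I : Set) → (I → Carrier) → Carrier → Set
    IsSup I g b = (∀ i → g i ≤ b) × (∀ u → (∀ i → g i ≤ u) → b ≤ u)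

    -- the Δ-set {β(s) | s ≪ t}, as an indexed family
    ΔSetIdx : Tree Carrier → Set
    ΔSetIdx t = Σ (FT Carrier) (λ s → s ≪ t)

    ΔSetFam : (t : Tree Carrier) → ΔSetIdx t → Carrier
    ΔSetFam t (s , _) = βᶠ s

    IsSupΔ : Tree Carrier → Carrier → Set
    IsSupΔ t b = IsSup (ΔSetIdx t) (ΔSetFam t) b

    record DeltaRegular (Δ : (X : Set) → Tree X → Set) : Set where
      field
        sup-exists : ∀ t → Δ Carrier t → ∃ λ b → IsSupΔ t b
        op-pres    : ∀ f (ts : Fin (ar f) → Tree Carrier) →
                     (∀ i → Δ Carrier (ts i)) →
                     (bs : Fin (ar f) → Carrier) →
                     (∀ i → IsSupΔ (ts i) (bs i)) →
                     IsSup ((i : Fin (ar f)) → ΔSetIdx (ts i))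
                           (λ c → opᴬ f (λ i → ΔSetFam (ts i) (c i)))
                           (opᴬ f bs)

-- β(μ T) ≤ β((Δβ) T): a finite s ≪ μ T is s' ≪ (Δβ) T with, at each leaf (t , p) of T,
-- a finite approximation of t grafted in; replacing it by β t p only increases the value.
-- β((Δβ) T) ≤ β(μ T): for s' ≪ (Δβ) T, graft the whole t at each such leaf instead. The
-- result is a Δ-term below μ T, and since the operations preserve suprema of Δ-sets its
-- supremum is at least βᶠ s'.

module Submission where

open import Defs
open import Data.Product using (Σ; ∃; _×_; _,_; proj₁; proj₂)
open import Data.Fin using (Fin; toℕ)
open import Data.Fin.Properties using (toℕ<n; fromℕ<-toℕ)
open import Data.Nat using (_<?_)
open import Data.Empty using (⊥-elim)
open import Data.List using ([]; _∷_)
open import Relation.Nullary using (yes; no)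
open import Relation.Binary.PropositionalEquality using (_≡_; refl; sym; trans; cong)

module _ {Σ' : RankedAlphabet} where
  open RankedAlphabet Σ'

  infix 4 _≪′_ _≐_

  _≪′_ : ∀ {X} → FT Σ' X → Tree Σ' X → Set
  _≪′_ = _≪_ Σ'

  _≐_ : ∀ {X} → Tree Σ' X → Tree Σ' X → Set
  _≐_ = _≗ᵗ_ Σ'

  ≪-resp-≐ : ∀ {X} {s : FT Σ' X} {t t' : Tree Σ' X} → s ≪′ t → t ≐ t' → s ≪′ t'
  ≪-resp-≐ ≪⊥         e = ≪⊥
  ≪-resp-≐ (≪var q)   e = ≪var (trans (sym (e [])) q)
  ≪-resp-≐ (≪op q hs) e = ≪op (trans (sym (e [])) q) (λ i → ≪-resp-≐ (hs i) (λ p → e (toℕ i ∷ p)))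

  subst-var : ∀ {X Y} (τ : X → Tree Σ' Y) (T : Tree Σ' X) {x} →
              T [] ≡ varₗ x → subst Σ' τ T ≐ τ x
  subst-var τ T e p with T []
  subst-var τ T refl p | _ = refl

  subst-op : ∀ {X Y} (τ : X → Tree Σ' Y) (T : Tree Σ' X) {f} →
             T [] ≡ opₗ f → subst Σ' τ T [] ≡ opₗ f
  subst-op τ T e with T []
  subst-op τ T refl | _ = refl

  sub-subst : ∀ {X Y} (τ : X → Tree Σ' Y) (T : Tree Σ' X) {f} → T [] ≡ opₗ f →
              ∀ i → sub Σ' (subst Σ' τ T) i ≐ subst Σ' τ (sub Σ' T i)
  sub-subst τ T e i p with T []
  sub-subst τ T refl i p | _ = refl

  sub-opᶜ : ∀ {X} f (us : Fin (ar f) → Tree Σ' X) i → sub Σ' (opᶜ Σ' f us) (toℕ i) ≐ us i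
  sub-opᶜ f us i p with toℕ i <? ar f
  ... | yes i<n = cong (λ j → us j p) (fromℕ<-toℕ i i<n)
  ... | no  i≮n = ⊥-elim (i≮n (toℕ<n i))

  ≪-opᶜ : ∀ {X} f {cs : Fin (ar f) → FT Σ' X} {us : Fin (ar f) → Tree Σ' X} →
          (∀ i → cs i ≪′ us i) → opᶠ f cs ≪′ opᶜ Σ' f us
  ≪-opᶜ f cs≪us = ≪op refl (λ i → ≪-resp-≐ (cs≪us i) (λ p → sym (sub-opᶜ f _ i p)))

  relabel-var⁻¹ : ∀ {X Y} {g : X → Y} (l : Lbl Σ' X) {y} →
                  relabel Σ' g l ≡ varₗ y → ∃ λ x → l ≡ varₗ x × g x ≡ y
  relabel-var⁻¹ (varₗ x) refl = x , refl , refl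

  relabel-op⁻¹ : ∀ {X Y} {g : X → Y} (l : Lbl Σ' X) {f} → relabel Σ' g l ≡ opₗ f → l ≡ opₗ f
  relabel-op⁻¹ (opₗ f) refl = refl

module _ {Σ' : RankedAlphabet} (A : OrderedAlgebra Σ') where
  open OrderedAlgebra A renaming (refl to ≤-refl; trans to ≤-trans)

  IsSup-mono : ∀ {I J : Set} {g : I → Carrier} {h : J → Carrier} {a b} →
               IsSup Σ' A I g a → IsSup Σ' A J h b →
               (∀ i → Σ J λ j → g i ≤ h j) → a ≤ b
  IsSup-mono (_ , least) (upper , _) dominated =
    least _ (λ i → ≤-trans (proj₂ (dominated i)) (upper (proj₁ (dominated i))))

  infix 4 _≼_

  _≼_ : Tree Σ' Carrier → Tree Σ' Carrier → Set
  u ≼ v = ∀ (i : ΔSetIdx Σ' A u) → Σ (ΔSetIdx Σ' A v) λ j → ΔSetFam Σ' A u i ≤ ΔSetFam Σ' A v j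

  ⊆⇒≼ : ∀ {u v} → (∀ {s} → s ≪′ u → s ≪′ v) → u ≼ v
  ⊆⇒≼ u⊆v (s , s≪u) = (s , u⊆v s≪u) , ≤-refl

  ≐⇒≼ : ∀ {u v} → u ≐ v → u ≼ v
  ≐⇒≼ u≐v = ⊆⇒≼ (λ s≪u → ≪-resp-≐ s≪u u≐v)

  IsSupΔ-leaf : ∀ {a b} → IsSupΔ Σ' A (leaf Σ' a) b → b ≈ a
  IsSupΔ-leaf {a} (upper , least) = antisym (least a below-a) (upper (varᶠ a , ≪var refl))
    where
    below-a : ∀ i → ΔSetFam Σ' A (leaf Σ' a) i ≤ a
    below-a (⊥ᶠ , _)              = ⊥-min a
    below-a (varᶠ _ , ≪var refl)  = ≤-refl
    below-a (opᶠ _ _ , ≪op () _)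

module EilenbergMoore {Σ' : RankedAlphabet} {Δ : (X : Set) → Tree Σ' X → Set}
  (QR : QuasiRegular Σ' Δ) {A : OrderedAlgebra Σ'} (DR : DeltaRegular Σ' A Δ)
  (β : (t : Tree Σ' (OrderedAlgebra.Carrier A)) → Δ (OrderedAlgebra.Carrier A) t →
       OrderedAlgebra.Carrier A)
  (β-sup : ∀ t (p : Δ (OrderedAlgebra.Carrier A) t) → IsSupΔ Σ' A t (β t p)) where
  open RankedAlphabet Σ'
  open OrderedAlgebra A renaming (refl to ≤-refl; trans to ≤-trans)
  open QuasiRegular QR
  open DeltaRegular DR

  ΔA : Set
  ΔA = Σ (Tree Σ' Carrier) (Δ Carrier)

  β̂ : ΔA → Carrier
  β̂ (t , p) = β t p

  μ : Tree Σ' ΔA → Tree Σ' Carrier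
  μ = subst Σ' proj₁

  Δβ : Tree Σ' ΔA → Tree Σ' Carrier
  Δβ = mapCT Σ' β̂

  βᶠ≤Δβ : ∀ T {s} → s ≪′ μ T →
          Σ (ΔSetIdx Σ' A (Δβ T)) λ j → βᶠ Σ' A s ≤ ΔSetFam Σ' A (Δβ T) j
  βᶠ≤Δβ T {s} s≪μT with T [] in eq
  ... | varₗ (t , p) = (varᶠ (β t p) , ≪var (cong (relabel Σ' β̂) eq)) , proj₁ (β-sup t p) (s , s≪μT)
  βᶠ≤Δβ T ≪⊥ | _ = (⊥ᶠ , ≪⊥) , ⊥-min _
  βᶠ≤Δβ T (≪op {ss = ss} refl ss≪μT) | opₗ f =
    (opᶠ f (λ i → proj₁ (proj₁ (rec i))) , ≪op (cong (relabel Σ' β̂) eq) (λ i → proj₂ (proj₁ (rec i)))) ,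
    mono f _ _ (λ i → proj₂ (rec i))
    where
    rec : ∀ i → Σ (ΔSetIdx Σ' A (Δβ (sub Σ' T (toℕ i)))) λ j →
                βᶠ Σ' A (ss i) ≤ ΔSetFam Σ' A (Δβ (sub Σ' T (toℕ i))) j
    rec i = βᶠ≤Δβ (sub Σ' T (toℕ i)) (ss≪μT i)
  βᶠ≤Δβ T (≪var ())  | none
  βᶠ≤Δβ T (≪var ())  | ⊥ₗ
  βᶠ≤Δβ T (≪var ())  | opₗ _
  βᶠ≤Δβ T (≪op () _) | none
  βᶠ≤Δβ T (≪op () _) | ⊥ₗ

  μ≼Δβ : ∀ T → _≼_ A (μ T) (Δβ T)
  μ≼Δβ T (s , s≪μT) = βᶠ≤Δβ T s≪μT

  truncate : FT Σ' Carrier → Tree Σ' ΔA → Tree Σ' Carrier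
  truncate ⊥ᶠ         T = ⊥ᶜ Σ'
  truncate (varᶠ _)   T = μ T
  truncate (opᶠ f ss) T = opᶜ Σ' f (λ i → truncate (ss i) (sub Σ' T (toℕ i)))

  truncate-Δ : ∀ T {s} → s ≪′ Δβ T → Δ Carrier (truncate s T)
  truncate-Δ T ≪⊥ = has-⊥
  truncate-Δ T (≪var root) with relabel-var⁻¹ (T []) root
  ... | (t , p) , T-root , _ = resp (λ q → sym (subst-var proj₁ T T-root q)) p
  truncate-Δ T (≪op _ ss≪) = has-op _ _ (λ i → truncate-Δ (sub Σ' T (toℕ i)) (ss≪ i))

  truncate⊆μ : ∀ T {s s₀} → s ≪′ Δβ T → s₀ ≪′ truncate s T → s₀ ≪′ μ T
  truncate⊆μ T (≪var _)    s₀≪               = s₀≪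
  truncate⊆μ T _           ≪⊥                = ≪⊥
  truncate⊆μ T ≪⊥          (≪var ())
  truncate⊆μ T ≪⊥          (≪op () _)
  truncate⊆μ T (≪op _ _)   (≪var ())
  truncate⊆μ T (≪op {f} root ss≪) (≪op refl cs≪) =
    ≪op (subst-op proj₁ T T-root) λ i →
      ≪-resp-≐ (truncate⊆μ (sub Σ' T (toℕ i)) (ss≪ i) (≪-resp-≐ (cs≪ i) (sub-opᶜ f _ i)))
               (λ q → sym (sub-subst proj₁ T T-root (toℕ i) q))
    where
    T-root : T [] ≡ opₗ f
    T-root = relabel-op⁻¹ (T []) root

  βᶠ≤sup-truncate : ∀ T {s b} → s ≪′ Δβ T → IsSupΔ Σ' A (truncate s T) b → βᶠ Σ' A s ≤ b
  βᶠ≤sup-truncate T ≪⊥ _ = ⊥-min _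
  βᶠ≤sup-truncate T (≪var root) sup with relabel-var⁻¹ (T []) root
  ... | (t , p) , T-root , refl =
    IsSup-mono A (β-sup t p) sup (≐⇒≼ A (λ q → sym (subst-var proj₁ T T-root q)))
  βᶠ≤sup-truncate T (≪op {f} {ss = ss} _ ss≪) sup =
    ≤-trans (mono f _ _ (λ i → βᶠ≤sup-truncate (sub Σ' T (toℕ i)) (ss≪ i) (proj₂ (sups i))))
            (proj₂ (op-pres f us us-Δ _ (λ i → proj₂ (sups i))) _ λ c →
               proj₁ sup (_ , ≪-opᶜ f (λ i → proj₂ (c i))))
    where
    us : Fin (ar f) → Tree Σ' Carrier
    us i = truncate (ss i) (sub Σ' T (toℕ i))
    us-Δ : ∀ i → Δ Carrier (us i)
    us-Δ i = truncate-Δ (sub Σ' T (toℕ i)) (ss≪ i)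
    sups : ∀ i → ∃ (IsSupΔ Σ' A (us i))
    sups i = sup-exists (us i) (us-Δ i)

  βᶠ≤βμ : ∀ T (p : Δ Carrier (μ T)) {s} → s ≪′ Δβ T → βᶠ Σ' A s ≤ β (μ T) p
  βᶠ≤βμ T p {s} s≪ = ≤-trans (βᶠ≤sup-truncate T s≪ (proj₂ sup))
                         (IsSup-mono A (proj₂ sup) (β-sup (μ T) p) (⊆⇒≼ A (truncate⊆μ T s≪)))
    where
    sup : ∃ (IsSupΔ Σ' A (truncate s T))
    sup = sup-exists _ (truncate-Δ T s≪)

  unit-law : ∀ a (p : Δ Carrier (leaf Σ' a)) → β (leaf Σ' a) p ≈ a
  unit-law a p = IsSupΔ-leaf A (β-sup _ p)

  multiplication-law : ∀ T (p₁ : Δ Carrier (μ T)) (p₂ : Δ Carrier (Δβ T)) →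
                       β (μ T) p₁ ≈ β (Δβ T) p₂
  multiplication-law T p₁ p₂ =
    antisym (IsSup-mono A (β-sup _ p₁) (β-sup _ p₂) (μ≼Δβ T))
            (proj₂ (β-sup _ p₂) _ λ (_ , s≪) → βᶠ≤βμ T p₁ s≪)

theorem3p4 : (Σ' : RankedAlphabet) (Δ : (X : Set) → Tree Σ' X → Set) →
    QuasiRegular Σ' Δ →
    (A : OrderedAlgebra Σ') → DeltaRegular Σ' A Δ →
    (β : (t : Tree Σ' (OrderedAlgebra.Carrier A)) → Δ (OrderedAlgebra.Carrier A) t →
         OrderedAlgebra.Carrier A) →
    (∀ t (p : Δ (OrderedAlgebra.Carrier A) t) → IsSupΔ Σ' A t (β t p)) →
    (∀ (a : OrderedAlgebra.Carrier A) (p : Δ (OrderedAlgebra.Carrier A) (leaf Σ' a)) →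
       OrderedAlgebra._≈_ A (β (leaf Σ' a) p) a)
    ×
    (∀ (T : Tree Σ' (Σ (Tree Σ' (OrderedAlgebra.Carrier A)) (Δ (OrderedAlgebra.Carrier A)))) →
       Δ (Σ (Tree Σ' (OrderedAlgebra.Carrier A)) (Δ (OrderedAlgebra.Carrier A))) T →
       (p₁ : Δ (OrderedAlgebra.Carrier A) (subst Σ' proj₁ T)) →
       (p₂ : Δ (OrderedAlgebra.Carrier A) (mapCT Σ' (λ tp → β (proj₁ tp) (Σ.proj₂ tp)) T)) →
       OrderedAlgebra._≈_ A (β (subst Σ' proj₁ T) p₁)
                            (β (mapCT Σ' (λ tp → β (proj₁ tp) (Σ.proj₂ tp)) T) p₂))
theorem3p4 Σ' Δ QR A DR β β-sup = unit-law , λ T _ → multiplication-law T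
  where open EilenbergMoore QR DR β β-sup
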